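{- Let $r\ge 2$ be an integer and let $n=R_r(3r,3r)-1$. Then there is a red/blue edge-coloring of the Kneser graph $\mathrm{KG}(n,r)$ that contains no red induced $\mathrm{KG}(3r,r)$ and no blue triangle. Consequently, the smallest $N\ge 3r$ such that every red/blue edge-coloring of $\mathrm{KG}(N,r)$ contains a red induced $\mathrm{KG}(3r,r)$ or a blue triangle satisfies $N\ge R_r(3r,3r)$.
   Context: The Kneser graph $\mathrm{KG}(n,r)$ has vertex set the $r$-element subsets of $[n]=\{1,\dots,n\}$, with two sets adjacent iff they are disjoint. An induced $\mathrm{KG}(3r,r)$ in $\mathrm{KG}(n,r)$ is the subgraph induced on the vertex set $\binom{S}{r}$ (all $r$-subsets of $S$) for some $S\subseteq[n]$ with $|S|=3r$; it is red if all of its edges are red. A blue triangle is three pairwise adjacent vertices whose three connecting edges are blue. $R_r(s,t)$ denotes the $r$-uniform hypergraph Ramsey number: the minimum $n$ such that in every red/blue coloring of the edges of the complete $r$-uniform hypergraph $K^r_n$ there is a red $s$-clique or a blue $t$-clique (a set of $s$, resp. $t$, vertices all of whose $r$-subsets have that color). -}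

module Defs where

open import Data.Nat using (ℕ; _≤_)
open import Data.Fin using (Fin)
open import Data.Fin.Subset using (Subset; _⊆_; _∈_; ∣_∣)
open import Data.Product using (Σ; _×_)
open import Data.Sum using (_⊎_)
open import Data.Empty using (⊥)
open import Relation.Binary.PropositionalEquality using (_≡_)

data Color : Set where
  red blue : Color

Disjoint : {n : ℕ} → Subset n → Subset n → Set
Disjoint {n} A B = (i : Fin n) → i ∈ A → i ∈ B → ⊥

-- A red/blue colouring of the edges of K^r_n: a colour for every subset
-- of [n]; only the values on r-subsets are relevant.
HyperColoring : ℕ → Set
HyperColoring n = Subset n → Color

MonoClique : {n : ℕ} → ℕ → HyperColoring n → Color → ℕ → Set
MonoClique {n} r χ col s =
  Σ (Subset n) λ S → (∣ S ∣ ≡ s) ×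
    ((T : Subset n) → T ⊆ S → ∣ T ∣ ≡ r → χ T ≡ col)

HyperRamseyProperty : ℕ → ℕ → ℕ → ℕ → Set
HyperRamseyProperty r s t n =
  (χ : HyperColoring n) → MonoClique r χ red s ⊎ MonoClique r χ blue t

IsHyperRamseyNumber : ℕ → ℕ → ℕ → ℕ → Set
IsHyperRamseyNumber r s t R =
  HyperRamseyProperty r s t R × ((m : ℕ) → HyperRamseyProperty r s t m → R ≤ m)

IsVertex : {n : ℕ} → ℕ → Subset n → Set
IsVertex r A = ∣ A ∣ ≡ r

-- A red/blue edge colouring of KG(n,r): a symmetric colour function on
-- pairs of subsets; only its values on edges (disjoint pairs of r-subsets)
-- are relevant.
record KneserColoring (n : ℕ) : Set where
  field
    col : Subset n → Subset n → Color
    sym : (A B : Subset n) → col A B ≡ col B A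
open KneserColoring public

-- A red induced KG(3r,r): S ⊆ [n] with |S| = 3r such that every edge of
-- KG(n,r) between r-subsets of S is red.
RedInducedKG3r : {n : ℕ} → ℕ → KneserColoring n → Set
RedInducedKG3r {n} r c =
  Σ (Subset n) λ S → (∣ S ∣ ≡ 3 Data.Nat.* r) ×
    ((A B : Subset n) → A ⊆ S → B ⊆ S → IsVertex r A → IsVertex r B →
      Disjoint A B → col c A B ≡ red)

BlueTriangle : {n : ℕ} → ℕ → KneserColoring n → Set
BlueTriangle {n} r c =
  Σ (Subset n) λ A → Σ (Subset n) λ B → Σ (Subset n) λ C →
    IsVertex r A × IsVertex r B × IsVertex r C ×
    Disjoint A B × Disjoint B C × Disjoint A C ×
    (col c A B ≡ blue) × (col c B C ≡ blue) × (col c A C ≡ blue)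

KneserArrows : ℕ → ℕ → Set
KneserArrows N r = (c : KneserColoring N) → RedInducedKG3r r c ⊎ BlueTriangle r c

-- Given a colouring χ of the r-subsets of [n], colour an edge AB of KG(n,r)
-- red iff χ A = χ B. With only two colours, three vertices cannot pairwise
-- disagree, so there is no blue triangle. A red induced KG(3r,r) on S forces
-- all r-subsets of S to have the same χ-colour, since any two r-subsets of a
-- 3r-set have a common r-subset disjoint from both; so S is a monochromatic
-- 3r-clique of χ. Applied to a colouring of K^r_{R-1} without monochromatic
-- 3r-cliques (one exists by minimality of R, and is found by a finite search
-- over all colourings) this gives the required colouring of KG(R-1,r);
-- applied to an arbitrary χ it shows that KG(N,r) → (KG(3r,r), triangle)
-- implies N → Ramsey, hence R ≤ N.
module Submission where

open import Defs
open import Data.Nat using (ℕ; _≤_; _*_; _∸_)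
open import Data.Product using (Σ; _×_)
open import Relation.Nullary using (¬_)

open import Data.Nat using (zero; suc; _+_; z≤n; s≤s)
open import Data.Nat.Properties
  using (_≟_; ≤-trans; ≤-reflexive; ≤-pred; n≤1+n; +-suc; +-identityʳ; +-monoʳ-≤; <-irrefl)
open import Data.Fin.Subset using (Subset; inside; outside; _⊆_; _∪_; ∣_∣; ⊥)
open import Data.Fin.Subset.Properties
  using (anySubset?; _⊆?_; ⊆-min; out⊆; in⊆in; ∉⊥; ∣⊥∣≡0; ∣p∣≤∣x∷p∣; p⊆p∪q; q⊆p∪q)
open import Data.Fin using () renaming (suc to fsuc)
open import Data.Vec using ([]; _∷_; there)
open import Data.Product using (_,_; ∃; Σ-syntax)
open import Data.Sum using (_⊎_; inj₁; inj₂)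
open import Data.Empty using (⊥-elim)
open import Function using (_∘_; const)
open import Level using (0ℓ)
open import Relation.Nullary using (Dec; yes; no)
open import Relation.Nullary.Decidable
  using (map′; ¬?; decidable-stable; _×-dec_; _⊎-dec_; _→-dec_)
open import Relation.Unary using (Pred; Decidable)
open import Relation.Binary.PropositionalEquality
  using (_≡_; refl; trans; cong; cong₂; subst; _≗_; module ≡-Reasoning) renaming (sym to ≡-sym)

private
  variable
    n r s t : ℕ

HasMonoClique : ℕ → ℕ → ℕ → HyperColoring n → Set
HasMonoClique r s t χ = MonoClique r χ red s ⊎ MonoClique r χ blue t

monoClique⇒HasMonoClique : {χ : HyperColoring n} (c : Color) →
  MonoClique r χ c s → HasMonoClique r s s χ
monoClique⇒HasMonoClique red  = inj₁
monoClique⇒HasMonoClique blue = inj₂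

agree : Color → Color → Color
agree red  red  = red
agree blue blue = red
agree _    _    = blue

agree-sym : ∀ x y → agree x y ≡ agree y x
agree-sym red  red  = refl
agree-sym red  blue = refl
agree-sym blue red  = refl
agree-sym blue blue = refl

agree≡red⇒≡ : ∀ {x y} → agree x y ≡ red → x ≡ y
agree≡red⇒≡ {red}  {red}  _ = refl
agree≡red⇒≡ {blue} {blue} _ = refl

agree-noBlueTriangle : ∀ x y z → agree x y ≡ blue → agree y z ≡ blue → ¬ agree x z ≡ blue
agree-noBlueTriangle red  blue red  _ _ ()
agree-noBlueTriangle blue red  blue _ _ ()

agreementColoring : HyperColoring n → KneserColoring n
agreementColoring χ = record
  { col = λ A B → agree (χ A) (χ B)
  ; sym = λ A B → agree-sym (χ A) (χ B)
  }

agreementColoring-noBlueTriangle : (χ : HyperColoring n) → ¬ BlueTriangle r (agreementColoring χ)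
agreementColoring-noBlueTriangle χ (A , B , C , _ , _ , _ , _ , _ , _ , AB , BC , AC) =
  agree-noBlueTriangle (χ A) (χ B) (χ C) AB BC AC

∣p∪q∣≤∣p∣+∣q∣ : (p q : Subset n) → ∣ p ∪ q ∣ ≤ ∣ p ∣ + ∣ q ∣
∣p∪q∣≤∣p∣+∣q∣ []            []            = z≤n
∣p∪q∣≤∣p∣+∣q∣ (outside ∷ p) (outside ∷ q) = ∣p∪q∣≤∣p∣+∣q∣ p q
∣p∪q∣≤∣p∣+∣q∣ (inside  ∷ p) (outside ∷ q) = s≤s (∣p∪q∣≤∣p∣+∣q∣ p q)
∣p∪q∣≤∣p∣+∣q∣ (outside ∷ p) (inside  ∷ q) =
  ≤-trans (s≤s (∣p∪q∣≤∣p∣+∣q∣ p q)) (≤-reflexive (≡-sym (+-suc _ _)))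
∣p∪q∣≤∣p∣+∣q∣ (inside  ∷ p) (inside  ∷ q) =
  s≤s (≤-trans (∣p∪q∣≤∣p∣+∣q∣ p q) (+-monoʳ-≤ _ (n≤1+n _)))

Disjoint-⊆ʳ : {C X Y : Subset n} → Y ⊆ X → Disjoint C X → Disjoint C Y
Disjoint-⊆ʳ Y⊆X C#X i i∈C i∈Y = C#X i i∈C (Y⊆X i∈Y)

Disjoint-outside∷ : ∀ x {C X : Subset n} → Disjoint C X → Disjoint (outside ∷ C) (x ∷ X)
Disjoint-outside∷ x C#X (fsuc i) (there i∈C) (there i∈X) = C#X i i∈C i∈X

Disjoint-inside∷ : {C X : Subset n} → Disjoint C X → Disjoint (inside ∷ C) (outside ∷ X)
Disjoint-inside∷ C#X (fsuc i) (there i∈C) (there i∈X) = C#X i i∈C i∈X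

AvoidingSubset : ℕ → (S X : Subset n) → Set
AvoidingSubset k S X = Σ[ C ∈ Subset _ ] (C ⊆ S × ∣ C ∣ ≡ k × Disjoint C X)

avoidingSubset : ∀ k (S X : Subset n) → k + ∣ X ∣ ≤ ∣ S ∣ → AvoidingSubset k S X
avoidingSubset {n} zero S X _ = ⊥ , ⊆-min S , ∣⊥∣≡0 n , λ _ i∈⊥ _ → ∉⊥ i∈⊥
avoidingSubset (suc k) (outside ∷ S) (x ∷ X) k+X≤S
  with C , C⊆S , ∣C∣≡k , C#X ← avoidingSubset (suc k) S X
         (≤-trans (+-monoʳ-≤ (suc k) (∣p∣≤∣x∷p∣ x X)) k+X≤S)
  = outside ∷ C , out⊆ C⊆S , ∣C∣≡k , Disjoint-outside∷ x C#X
avoidingSubset (suc k) (inside ∷ S) (inside ∷ X) k+X≤S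
  with C , C⊆S , ∣C∣≡k , C#X ← avoidingSubset (suc k) S X
         (≤-pred (subst (_≤ suc ∣ S ∣) (+-suc (suc k) ∣ X ∣) k+X≤S))
  = outside ∷ C , out⊆ C⊆S , ∣C∣≡k , Disjoint-outside∷ inside C#X
avoidingSubset (suc k) (inside ∷ S) (outside ∷ X) k+X≤S
  with C , C⊆S , ∣C∣≡k , C#X ← avoidingSubset k S X (≤-pred k+X≤S)
  = inside ∷ C , in⊆in C⊆S , cong suc ∣C∣≡k , Disjoint-inside∷ C#X

commonNeighbour : {S T T′ : Subset n} → ∣ S ∣ ≡ 3 * r → ∣ T ∣ ≡ r → ∣ T′ ∣ ≡ r →
  Σ[ C ∈ Subset n ] (C ⊆ S × ∣ C ∣ ≡ r × Disjoint T C × Disjoint C T′)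
commonNeighbour {r = r} {S} {T} {T′} ∣S∣≡3r ∣T∣≡r ∣T′∣≡r =
  let C , C⊆S , ∣C∣≡r , C#T∪T′ = avoidingSubset r S (T ∪ T′) r+∣T∪T′∣≤∣S∣
  in  C , C⊆S , ∣C∣≡r
    , (λ i i∈T i∈C → Disjoint-⊆ʳ (p⊆p∪q T′) C#T∪T′ i i∈C i∈T)
    , Disjoint-⊆ʳ (q⊆p∪q T T′) C#T∪T′
  where
  open ≡-Reasoning
  r+∣T∪T′∣≤∣S∣ : r + ∣ T ∪ T′ ∣ ≤ ∣ S ∣
  r+∣T∪T′∣≤∣S∣ = ≤-trans (+-monoʳ-≤ r (∣p∪q∣≤∣p∣+∣q∣ T T′)) (≤-reflexive (begin
    r + (∣ T ∣ + ∣ T′ ∣) ≡⟨ cong₂ (λ a b → r + (a + b)) ∣T∣≡r ∣T′∣≡r ⟩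
    r + (r + r)         ≡⟨ cong (λ a → r + (r + a)) (≡-sym (+-identityʳ r)) ⟩
    3 * r               ≡⟨ ≡-sym ∣S∣≡3r ⟩
    ∣ S ∣               ∎))

redInducedKG⇒monoClique : (χ : HyperColoring n) → RedInducedKG3r r (agreementColoring χ) →
  HasMonoClique r (3 * r) (3 * r) χ
redInducedKG⇒monoClique {n} {r} χ (S , ∣S∣≡3r , allRed) =
  let T₀ , T₀⊆S , ∣T₀∣≡r , _ = avoidingSubset r S ⊥ r+∣⊥∣≤∣S∣
  in  monoClique⇒HasMonoClique (χ T₀)
        (S , ∣S∣≡3r , λ T T⊆S ∣T∣≡r → sameColour T⊆S ∣T∣≡r T₀⊆S ∣T₀∣≡r)
  where
  r+∣⊥∣≤∣S∣ : r + ∣ ⊥ {n} ∣ ≤ ∣ S ∣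
  r+∣⊥∣≤∣S∣ rewrite ∣⊥∣≡0 n | ∣S∣≡3r = +-monoʳ-≤ r z≤n

  sameColour : {T T′ : Subset n} → T ⊆ S → ∣ T ∣ ≡ r → T′ ⊆ S → ∣ T′ ∣ ≡ r → χ T ≡ χ T′
  sameColour {T} {T′} T⊆S ∣T∣≡r T′⊆S ∣T′∣≡r =
    let C , C⊆S , ∣C∣≡r , T#C , C#T′ = commonNeighbour ∣S∣≡3r ∣T∣≡r ∣T′∣≡r
    in  trans (agree≡red⇒≡ (allRed T C T⊆S C⊆S ∣T∣≡r ∣C∣≡r T#C))
              (agree≡red⇒≡ (allRed C T′ C⊆S T′⊆S ∣C∣≡r ∣T′∣≡r C#T′))

kneserArrows⇒hyperRamsey : (N r : ℕ) → KneserArrows N r → HyperRamseyProperty r (3 * r) (3 * r) N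
kneserArrows⇒hyperRamsey N r arrows χ with arrows (agreementColoring χ)
... | inj₁ redKG    = redInducedKG⇒monoClique χ redKG
... | inj₂ triangle = ⊥-elim (agreementColoring-noBlueTriangle χ triangle)

_≟ᶜ_ : (x y : Color) → Dec (x ≡ y)
red  ≟ᶜ red  = yes refl
red  ≟ᶜ blue = no λ ()
blue ≟ᶜ red  = no λ ()
blue ≟ᶜ blue = yes refl

allSubsets? : {P : Pred (Subset n) 0ℓ} → Decidable P → Dec (∀ S → P S)
allSubsets? P? = map′
  (λ ¬∃¬P S → decidable-stable (P? S) (λ ¬PS → ¬∃¬P (S , ¬PS)))
  (λ ∀P (S , ¬PS) → ¬PS (∀P S))
  (¬? (anySubset? (¬? ∘ P?)))

monoClique? : ∀ r (χ : HyperColoring n) c s → Dec (MonoClique r χ c s)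
monoClique? r χ c s = anySubset? λ S → (∣ S ∣ ≟ s) ×-dec allSubsets? λ T →
  T ⊆? S →-dec ∣ T ∣ ≟ r →-dec χ T ≟ᶜ c

hasMonoClique? : ∀ r s t (χ : HyperColoring n) → Dec (HasMonoClique r s t χ)
hasMonoClique? r s t χ = monoClique? r χ red s ⊎-dec monoClique? r χ blue t

monoClique-resp-≗ : {χ ψ : HyperColoring n} {c : Color} → χ ≗ ψ →
  MonoClique r χ c s → MonoClique r ψ c s
monoClique-resp-≗ χ≗ψ (S , ∣S∣≡s , mono) =
  S , ∣S∣≡s , λ T T⊆S ∣T∣≡r → trans (≡-sym (χ≗ψ T)) (mono T T⊆S ∣T∣≡r)

hasMonoClique-resp-≗ : {χ ψ : HyperColoring n} → χ ≗ ψ →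
  HasMonoClique r s t χ → HasMonoClique r s t ψ
hasMonoClique-resp-≗ χ≗ψ (inj₁ redClique)  = inj₁ (monoClique-resp-≗ χ≗ψ redClique)
hasMonoClique-resp-≗ χ≗ψ (inj₂ blueClique) = inj₂ (monoClique-resp-≗ χ≗ψ blueClique)

Exhaustible : Set → Set₁
Exhaustible A = {P : Pred A 0ℓ} → Decidable P → Dec (∃ P)

-- Without function extensionality, a search over functions can only decide
-- predicates that cannot tell pointwise equal functions apart.
Extensional : {A B : Set} → Pred (A → B) 0ℓ → Set
Extensional P = ∀ {f g} → f ≗ g → P f → P g

anyColor? : Exhaustible Color
anyColor? P? = map′
  (λ { (inj₁ p) → red , p ; (inj₂ p) → blue , p })
  (λ { (red , p) → inj₁ p ; (blue , p) → inj₂ p })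
  (P? red ⊎-dec P? blue)

joinSubsetFunctions : {A : Set} → (Subset n → A) → (Subset n → A) → Subset (suc n) → A
joinSubsetFunctions f g (inside  ∷ S) = f S
joinSubsetFunctions f g (outside ∷ S) = g S

anyFunction? : {A : Set} → Exhaustible A → (n : ℕ) {P : Pred (Subset n → A) 0ℓ} →
  Extensional P → Decidable P → Dec (∃ P)
anyFunction? any? zero resp P? = map′
  (λ (a , Pa) → const a , Pa)
  (λ (f , Pf) → f [] , resp (λ { [] → refl }) Pf)
  (any? (P? ∘ const))
anyFunction? any? (suc n) resp P? = map′
  (λ (f , g , Pfg) → joinSubsetFunctions f g , Pfg)
  (λ (h , Ph) → h ∘ (inside ∷_) , h ∘ (outside ∷_) , resp split Ph)
  (anyFunction? any? n
    (λ f≗f′ (g , Pfg) → g , resp (λ { (inside ∷ S) → f≗f′ S ; (outside ∷ S) → refl }) Pfg)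
    (λ f → anyFunction? any? n
      (λ g≗g′ → resp (λ { (inside ∷ S) → refl ; (outside ∷ S) → g≗g′ S }))
      (P? ∘ joinSubsetFunctions f)))
  where
  split : ∀ {h} → h ≗ joinSubsetFunctions (h ∘ (inside ∷_)) (h ∘ (outside ∷_))
  split (inside  ∷ S) = refl
  split (outside ∷ S) = refl

¬hyperRamsey⇒coloring : ¬ HyperRamseyProperty r s t n →
  Σ[ χ ∈ HyperColoring n ] ¬ HasMonoClique r s t χ
¬hyperRamsey⇒coloring {r} {s} {t} {n} ¬ramsey
  with anyFunction? anyColor? n (λ χ≗ψ ¬ψ → ¬ψ ∘ hasMonoClique-resp-≗ (≡-sym ∘ χ≗ψ))
                                 (¬? ∘ hasMonoClique? r s t)
... | yes good = good
... | no  none = ⊥-elim (¬ramsey λ χ →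
        decidable-stable (hasMonoClique? r s t χ) (λ ¬has → none (χ , ¬has)))

hyperRamsey-pred-fails : {R : ℕ} → IsHyperRamseyNumber r (suc s) (suc t) R →
  ¬ HyperRamseyProperty r (suc s) (suc t) (R ∸ 1)
hyperRamsey-pred-fails {R = zero} _ ramsey with ramsey (const red)
... | inj₁ ([] , () , _)
... | inj₂ ([] , () , _)
hyperRamsey-pred-fails {R = suc R} (_ , minimal) ramsey = <-irrefl refl (minimal R ramsey)

theorem1p14 : (r : ℕ) → 2 ≤ r → (R : ℕ) → IsHyperRamseyNumber r (3 * r) (3 * r) R →
    Σ (KneserColoring (R ∸ 1)) (λ c → ¬ RedInducedKG3r r c × ¬ BlueTriangle r c)
    × ((N : ℕ) → 3 * r ≤ N → KneserArrows N r → R ≤ N)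
theorem1p14 r (s≤s (s≤s _)) R isRamsey@(_ , minimal) =
  let χ , noMonoClique = ¬hyperRamsey⇒coloring (hyperRamsey-pred-fails isRamsey)
  in  (agreementColoring χ
      , noMonoClique ∘ redInducedKG⇒monoClique χ
      , agreementColoring-noBlueTriangle χ)
    , λ N _ arrows → minimal N (kneserArrows⇒hyperRamsey N r arrows)
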